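{- Let $G$ be a digraph on $n$ vertices and let $\delta = \delta^+(G)/n$. Let $x \in V(G)$ with $d^-(x) > 2( 1 - \delta ) n$. Then $N(x) = N^+(x) \cup N^-(x)$ is weakly connected in $G$.
   Context: A digraph has no loops and at most one arc from $x$ to $y$ for each ordered pair $(x,y)$ (arcs in both directions are allowed). $N^+(v)$, $N^-(v)$ are the out- and in-neighbourhoods, $d^+(v)$, $d^-(v)$ their sizes, and $\delta^+(G)$ the minimum out-degree. The base graph of a digraph is the undirected graph with an edge $xy$ whenever $xy$ or $yx$ is an arc. $\mathcal{K}_{3,1}(G)$ is the set of subdigraphs of $G$ on $3$ vertices whose base graph is a triangle and whose minimum out-degree (within the subdigraph) is at least $1$; for a 3-set $S$ we write $G[S] \in \mathcal{K}_{3,1}(G)$ if the induced subdigraph has this property. Two vertices $x,x'$ are weakly $s$-connected if there is a vertex multiset $W$ with $|W| = 3s-1$ such that each of the multisets $\{x\} \cup W$ and $\{x'\} \cup W$ can be partitioned into $S_1,\dots,S_s$ where each $S_i$ consists of three distinct vertices with $G[S_i] \in \mathcal{K}_{3,1}(G)$. A set $U \subseteq V(G)$ is weakly $s$-connected in $G$ if every pair of vertices of $U$ is weakly $s$-connected, and weakly connected if it is weakly $s$-connected for some $s \in \mathbb{N}$. -}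

module Defs where

open import Data.Nat using (ℕ; zero; suc; _+_; _*_; _∸_; _⊓_; _≤_; _<_)
open import Data.Bool using (Bool; true; false)
open import Data.Fin using (Fin)
open import Data.List using (List; []; _∷_; map; foldr; concatMap; length)
open import Data.List.Relation.Unary.All using (All)
open import Data.List.Relation.Binary.Permutation.Propositional using (_↭_)
open import Data.Vec using (Vec; toList)
open import Data.Vec using (allFin) renaming (toList to vecToList)
open import Data.Product using (Σ; _×_; _,_; ∃-syntax)
open import Data.Sum using (_⊎_)
open import Relation.Binary.PropositionalEquality using (_≡_; _≢_)

-- A digraph on vertex set Fin n: Boolean adjacency (arc x → y iff adj x y ≡ true),
-- no loops.  At most one arc per ordered pair is automatic; both directions allowed.
record Digraph (n : ℕ) : Set where
  field
    adj    : Fin n → Fin n → Bool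
    noLoop : ∀ x → adj x x ≡ false
open Digraph public

module _ {n : ℕ} (G : Digraph n) where

  Arc : Fin n → Fin n → Set
  Arc x y = adj G x y ≡ true

  vertices : List (Fin n)
  vertices = vecToList (allFin n)

  countTrue : List Bool → ℕ
  countTrue [] = 0
  countTrue (true ∷ bs) = suc (countTrue bs)
  countTrue (false ∷ bs) = countTrue bs

  outDeg : Fin n → ℕ
  outDeg v = countTrue (map (λ y → adj G v y) vertices)

  inDeg : Fin n → ℕ
  inDeg v = countTrue (map (λ y → adj G y v) vertices)

  -- δ⁺(G): minimum out-degree.  Folded with initial value n, which exceeds every
  -- out-degree (≤ n - 1), so for n ≥ 1 this is exactly the minimum.
  minOutDeg : ℕ
  minOutDeg = foldr _⊓_ n (map outDeg vertices)

  Nbhd : Fin n → Fin n → Set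
  Nbhd x u = Arc x u ⊎ Arc u x

  Adjacent : Fin n → Fin n → Set
  Adjacent a b = Arc a b ⊎ Arc b a

  -- G[{a,b,c}] ∈ K_{3,1}(G), for three distinct vertices a, b, c:
  -- base graph is a triangle and every vertex has out-degree ≥ 1 inside.
  InK31 : Fin n × Fin n × Fin n → Set
  InK31 (a , b , c) =
    (a ≢ b × b ≢ c × a ≢ c)
    × (Adjacent a b × Adjacent b c × Adjacent a c)
    × ((Arc a b ⊎ Arc a c) × (Arc b a ⊎ Arc b c) × (Arc c a ⊎ Arc c b))

  triple→list : Fin n × Fin n × Fin n → List (Fin n)
  triple→list (a , b , c) = a ∷ b ∷ c ∷ []

  -- The multiset M (given as a list, up to permutation) can be partitioned into
  -- s triples S₁,…,S_s each with G[Sᵢ] ∈ K_{3,1}(G).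
  K31Partition : ℕ → List (Fin n) → Set
  K31Partition s M =
    Σ (List (Fin n × Fin n × Fin n)) λ Ss →
      (length Ss ≡ s) × All InK31 Ss × (concatMap triple→list Ss ↭ M)

  WeaklySConnected : ℕ → Fin n → Fin n → Set
  WeaklySConnected s x x' =
    Σ (List (Fin n)) λ W →
      (length W ≡ 3 * s ∸ 1)
      × K31Partition s (x ∷ W) × K31Partition s (x' ∷ W)

  WeaklySConnectedSet : ℕ → (Fin n → Set) → Set
  WeaklySConnectedSet s U = ∀ u v → U u → U v → u ≢ v → WeaklySConnected s u v

  WeaklyConnectedSet : (Fin n → Set) → Set
  WeaklyConnectedSet U = Σ ℕ λ s → (1 ≤ s) × WeaklySConnectedSet s U

-- Three subsets of an n-set whose sizes sum to more than 2n have a common element.  As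
-- d⁻(x) + 2δ⁺(G) > 2n, any two vertices z₁, z₂ thus have a common out-neighbour in N⁻(x).
-- With z₁ = x this gives, for each u ∈ N(x), a vertex a with x ⇄ a and u → a, so that
-- {u, x, a} ∈ K_{3,1}(G).  For u, v ∈ N(x) with such partners a and c, a common
-- out-neighbour y ∈ N⁻(x) of a and c makes {y, x, a} and {y, x, c} members of K_{3,1}(G)
-- too, and with W = {x, a, y, x, c} the partitions {u, x, a}, {y, x, c} and {y, x, a},
-- {v, x, c} show that u and v are weakly 2-connected.
module Submission where

open import Defs
open import Data.Nat using (ℕ; _+_; _*_; _<_)
open import Data.Fin using (Fin)

open import Data.Bool using (Bool; true; false)
open import Data.List using (List; []; _∷_; _++_; map; length)
open import Data.List.Properties using (foldr-forcesᵇ)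
open import Data.List.Relation.Unary.All using (_∷_; []; lookup)
open import Data.List.Relation.Unary.All.Properties using (map⁻)
open import Data.List.Relation.Binary.Permutation.Propositional
  using (_↭_; refl; prep; swap; ↭-sym; module PermutationReasoning)
open import Data.List.Relation.Binary.Permutation.Propositional.Properties using (shift)
open import Data.Nat using (_≤_; _⊓_; z≤n; s≤s)
open import Data.Nat.Properties
open import Algebra.Properties.CommutativeSemigroup +-commutativeSemigroup using (interchange)
open import Data.Product using (_×_; _,_; ∃-syntax)
open import Data.Sum using (_⊎_; inj₁; inj₂) renaming (swap to ⊎-swap)
open import Data.Vec using (allFin)
open import Data.Vec.Membership.Propositional.Properties using (∈-allFin⁺; ∈-toList⁺)
open import Data.Vec.Properties using (length-toList)
open import Function using (_∘_)
open import Relation.Binary.PropositionalEquality using (_≡_; _≢_; refl; sym; trans; cong; cong₂)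

boolToℕ : Bool → ℕ
boolToℕ true  = 1
boolToℕ false = 0

boolToℕ≤1 : ∀ b → boolToℕ b ≤ 1
boolToℕ≤1 true  = s≤s z≤n
boolToℕ≤1 false = z≤n

all-true-or-sum≤2 : ∀ b₁ b₂ b₃ →
  (b₁ ≡ true × b₂ ≡ true × b₃ ≡ true) ⊎ boolToℕ b₁ + boolToℕ b₂ + boolToℕ b₃ ≤ 2
all-true-or-sum≤2 true  true  true  = inj₁ (refl , refl , refl)
all-true-or-sum≤2 true  true  false = inj₂ ≤-refl
all-true-or-sum≤2 true  false b₃    = inj₂ (s≤s (boolToℕ≤1 b₃))
all-true-or-sum≤2 false b₂    b₃    = inj₂ (+-mono-≤ (boolToℕ≤1 b₂) (boolToℕ≤1 b₃))

↭-exchange : ∀ {A : Set} (x y : A) (xs ys : List A) → x ∷ xs ++ y ∷ ys ↭ y ∷ xs ++ x ∷ ys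
↭-exchange x y xs ys = begin
  x ∷ xs ++ y ∷ ys  ↭⟨ prep x (shift y xs ys) ⟩
  x ∷ y ∷ xs ++ ys  ↭⟨ swap x y refl ⟩
  y ∷ x ∷ xs ++ ys  ↭⟨ prep y (↭-sym (shift x xs ys)) ⟩
  y ∷ xs ++ x ∷ ys  ∎
  where open PermutationReasoning

module _ {n : ℕ} (G : Digraph n) where

  countTrue-∷ : ∀ b bs → countTrue G (b ∷ bs) ≡ boolToℕ b + countTrue G bs
  countTrue-∷ true  bs = refl
  countTrue-∷ false bs = refl

  common-true : ∀ {A : Set} (f g h : A → Bool) (l : List A) →
    2 * length l < countTrue G (map f l) + countTrue G (map g l) + countTrue G (map h l) →
    ∃[ a ] f a ≡ true × g a ≡ true × h a ≡ true
  common-true f g h []      ()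
  common-true f g h (a ∷ l) total with all-true-or-sum≤2 (f a) (g a) (h a)
  ... | inj₁ all-true = a , all-true
  ... | inj₂ head≤2   = common-true f g h l (+-cancelˡ-< 2 _ _ (begin-strict
      2 + 2 * length l                                   ≡⟨ *-suc 2 (length l) ⟨
      2 * length (a ∷ l)                                 <⟨ total ⟩
      counts (a ∷ l)                                     ≡⟨ counts-∷ ⟩
      (fa + ga + ha) + (X + Y + Z)                       ≤⟨ +-monoˡ-≤ (X + Y + Z) head≤2 ⟩
      2 + (X + Y + Z)                                    ∎))
    where
      open ≤-Reasoning
      fa = boolToℕ (f a)
      ga = boolToℕ (g a)
      ha = boolToℕ (h a)
      X = countTrue G (map f l)
      Y = countTrue G (map g l)
      Z = countTrue G (map h l)
      counts : List _ → ℕ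
      counts ys = countTrue G (map f ys) + countTrue G (map g ys) + countTrue G (map h ys)
      counts-∷ : counts (a ∷ l) ≡ (fa + ga + ha) + (X + Y + Z)
      counts-∷ = trans
        (cong₂ _+_ (cong₂ _+_ (countTrue-∷ (f a) _) (countTrue-∷ (g a) _)) (countTrue-∷ (h a) _))
        (trans (cong₂ _+_ (interchange fa X ga Y) refl) (interchange (fa + ga) (X + Y) ha Z))

  length-vertices : length (vertices G) ≡ n
  length-vertices = length-toList (allFin n)

  minOutDeg≤outDeg : ∀ z → minOutDeg G ≤ outDeg G z
  minOutDeg≤outDeg z =
    lookup (map⁻ (foldr-forcesᵇ ⊓-forces n _ ≤-refl)) (∈-toList⁺ (∈-allFin⁺ z))
    where
      ⊓-forces : ∀ a b → minOutDeg G ≤ a ⊓ b → minOutDeg G ≤ a × minOutDeg G ≤ b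
      ⊓-forces a b m≤a⊓b = m≤n⊓o⇒m≤n a b m≤a⊓b , m≤n⊓o⇒m≤o a b m≤a⊓b

  arc⇒≢ : ∀ {p q} → Arc G p q → p ≢ q
  arc⇒≢ {p} p→p refl with trans (sym p→p) (noLoop G p)
  ... | ()

  adjacent⇒≢ : ∀ {p q} → Adjacent G p q → p ≢ q
  adjacent⇒≢ (inj₁ p→q) = arc⇒≢ p→q
  adjacent⇒≢ (inj₂ q→p) = arc⇒≢ q→p ∘ sym

  digon-InK31 : ∀ {w x a} → Arc G x a → Arc G a x → Adjacent G w x → Adjacent G w a →
    Arc G w x ⊎ Arc G w a → InK31 G (w , x , a)
  digon-InK31 x→a a→x w~x w~a w→ =
    (adjacent⇒≢ w~x , arc⇒≢ x→a , adjacent⇒≢ w~a)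
    , (w~x , inj₁ x→a , w~a)
    , (w→ , inj₂ x→a , inj₂ a→x)

  exchange⇒weakly2Connected : ∀ {u v y p q r s} →
    InK31 G (u , p , q) → InK31 G (y , r , s) → InK31 G (y , p , q) → InK31 G (v , r , s) →
    WeaklySConnected G 2 u v
  exchange⇒weakly2Connected {u} {v} {y} {p} {q} {r} {s} upq yrs ypq vrs =
    (p ∷ q ∷ y ∷ r ∷ s ∷ []) , refl
    , (((u , p , q) ∷ (y , r , s) ∷ []) , refl , upq ∷ yrs ∷ [] , refl)
    , (((y , p , q) ∷ (v , r , s) ∷ []) , refl , ypq ∷ vrs ∷ []
       , ↭-exchange y v (p ∷ q ∷ []) (r ∷ s ∷ []))

  module _ {x : Fin n} (dense : 2 * n < inDeg G x + 2 * minOutDeg G) where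

    common-outNeighbour-in-N⁻ : ∀ z₁ z₂ → ∃[ a ] Arc G a x × Arc G z₁ a × Arc G z₂ a
    common-outNeighbour-in-N⁻ z₁ z₂ =
      common-true (λ a → adj G a x) (adj G z₁) (adj G z₂) (vertices G) (begin-strict
        2 * length (vertices G)                       ≡⟨ cong (2 *_) length-vertices ⟩
        2 * n                                         <⟨ dense ⟩
        inDeg G x + (δ + (δ + 0))
          ≤⟨ +-monoʳ-≤ (inDeg G x)
               (+-mono-≤ (minOutDeg≤outDeg z₁) (+-monoˡ-≤ 0 (minOutDeg≤outDeg z₂))) ⟩
        inDeg G x + (outDeg G z₁ + (outDeg G z₂ + 0))
          ≡⟨ cong (λ k → inDeg G x + (outDeg G z₁ + k)) (+-identityʳ _) ⟩
        inDeg G x + (outDeg G z₁ + outDeg G z₂)       ≡⟨ +-assoc (inDeg G x) _ _ ⟨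
        inDeg G x + outDeg G z₁ + outDeg G z₂         ∎)
      where
        open ≤-Reasoning
        δ = minOutDeg G

    digon-partner : ∀ {u} → Nbhd G x u → ∃[ a ] Arc G x a × Arc G a x × InK31 G (u , x , a)
    digon-partner {u} u∈N with common-outNeighbour-in-N⁻ x u
    ... | a , a→x , x→a , u→a =
      a , x→a , a→x , digon-InK31 x→a a→x (⊎-swap u∈N) (inj₁ u→a) (inj₂ u→a)

    neighbours-weakly2Connected : ∀ {u v} → Nbhd G x u → Nbhd G x v → WeaklySConnected G 2 u v
    neighbours-weakly2Connected u∈N v∈N with digon-partner u∈N | digon-partner v∈N
    ... | a , x→a , a→x , uxa | c , x→c , c→x , vxc with common-outNeighbour-in-N⁻ a c
    ... | y , y→x , a→y , c→y = exchange⇒weakly2Connected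
      uxa (inN⁻-InK31 x→c c→x y→x c→y) (inN⁻-InK31 x→a a→x y→x a→y) vxc
      where
        inN⁻-InK31 : ∀ {b} → Arc G x b → Arc G b x → Arc G y x → Arc G b y → InK31 G (y , x , b)
        inN⁻-InK31 x→b b→x y→x b→y = digon-InK31 x→b b→x (inj₁ y→x) (inj₂ b→y) (inj₁ y→x)

propositionA5 : (n : ℕ) (G : Digraph n) (x : Fin n) →
    2 * n < inDeg G x + 2 * minOutDeg G →
    WeaklyConnectedSet G (Nbhd G x)
propositionA5 n G x dense =
  2 , s≤s z≤n , λ _ _ u∈N v∈N _ → neighbours-weakly2Connected G dense u∈N v∈N
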